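{- For all integers $k,n$ with $0\le k\le n$, there exists a family $\mathcal{F}\subseteq 2^{[n]}$ with $|\mathcal{F}|=2^k\binom{n-k}{\lfloor (n-k)/2\rfloor}$ such that every component of $G_\mathcal{F}$ has order exactly $2^k$.
   Context: For $\mathcal{F}\subseteq 2^{[n]}$, $G_\mathcal{F}$ is the graph with vertex set $\mathcal{F}$ in which distinct $A,B\in\mathcal{F}$ are adjacent iff $A\subseteq B$ or $B\subseteq A$. The order of a component is its number of vertices. -}

module Defs where

open import Data.Nat using (ℕ)
open import Data.Fin.Subset using (Subset; _⊆_)
open import Data.List using (List)
open import Data.List.Membership.Propositional using (_∈_)
open import Data.Product using (_×_)
open import Data.Sum using (_⊎_)
open import Relation.Nullary using (¬_)
open import Relation.Binary.PropositionalEquality using (_≡_)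
open import Relation.Binary.Construct.Closure.ReflexiveTransitive using (Star)

-- A family 𝓕 ⊆ 2^[n] is represented as a list of subsets of Fin n
-- (duplicate-freeness is imposed separately where needed).
Family : ℕ → Set
Family n = List (Subset n)

Adj : ∀ {n} → Family n → Subset n → Subset n → Set
Adj 𝓕 A B = (A ∈ 𝓕) × (B ∈ 𝓕) × (¬ (A ≡ B)) × ((A ⊆ B) ⊎ (B ⊆ A))

Connected : ∀ {n} → Family n → Subset n → Subset n → Set
Connected 𝓕 = Star (Adj 𝓕)

IsComponentOf : ∀ {n} → Family n → Subset n → List (Subset n) → Set
IsComponentOf 𝓕 A C = ∀ B → (B ∈ C → (B ∈ 𝓕 × Connected 𝓕 A B))
                          × ((B ∈ 𝓕 × Connected 𝓕 A B) → B ∈ C)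

{-# OPTIONS --safe #-}
module Submission where

-- Write n = k + m, a subset of [n] as T ++ S with T ⊆ [k] and S ⊆ [m], and take
-- 𝓕 = {T ++ S : ∣ S ∣ = ⌊m/2⌋}.  If T ++ S ⊆ T′ ++ S′ then S ⊆ S′, so S = S′ as
-- both have the same size; hence walks in G_𝓕 never change S.  Conversely every
-- T ++ S contains ⊥ ++ S, so the components are exactly the cubes
-- {T ++ S : T ⊆ [k]}.

open import Defs
open import Level using (Level)
open import Data.Nat using (ℕ; zero; suc; _+_; _≤_; _*_; _^_; _∸_; _/_)
open import Data.Nat.Properties using (+-comm; +-identityʳ; suc-injective; n≮n; m+n∸m≡n; m≤n⇒∃[o]m+o≡n)
open import Data.Nat.Combinatorics using (_C_; nCk+nC[k+1]≡[n+1]C[k+1])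
import Data.Bool as Bool
open import Data.List as List using (List; []; _∷_; [_]; length; map; cartesianProductWith)
open import Data.List.Properties using (length-map; length-++)
open import Data.List.Relation.Unary.All as All using (All)
import Data.List.Relation.Unary.All.Properties as All
open import Data.List.Relation.Unary.Any using (here)
open import Data.List.Relation.Unary.Unique.Propositional using (Unique)
import Data.List.Relation.Unary.Unique.Propositional.Properties as Unique
open import Data.List.Membership.Propositional using (_∈_)
open import Data.List.Membership.Propositional.Properties using (∈-map⁺; ∈-map⁻; ∈-++⁺ˡ; ∈-++⁺ʳ; ∈-cartesianProductWith⁺; ∈-cartesianProductWith⁻)
open import Data.Vec as Vec using (Vec; []; _∷_; _++_; drop)
open import Data.Vec.Properties using (∷-injectiveʳ; ++-injective; ++-injectiveˡ; ≡-dec)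
open import Data.Fin.Subset using (Subset; ∣_∣; _⊆_; ⊥; inside; outside)
open import Data.Fin.Subset.Properties using (drop-∷-⊆; out⊆; p⊆q⇒∣p∣≤∣q∣)
open import Data.Product using (Σ; _×_; _,_)
open import Data.Sum using (inj₁; inj₂)
open import Function using (_∘_)
open import Relation.Nullary using (¬_; yes; no; contradiction)
open import Relation.Binary.PropositionalEquality using (_≡_; refl; sym; trans; cong; cong₂; subst; module ≡-Reasoning)
open import Relation.Binary.Construct.Closure.ReflexiveTransitive using (ε; _◅_; _◅◅_; fold; reverse)

private
  variable
    a : Level
    X Y Z : Set a
    k m n : ℕ

length-cartesianProductWith : (f : X → Y → Z) (xs : List X) (ys : List Y) →
  length (cartesianProductWith f xs ys) ≡ length xs * length ys
length-cartesianProductWith f []       ys = refl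
length-cartesianProductWith f (x ∷ xs) ys = begin
  length (map (f x) ys List.++ cartesianProductWith f xs ys)
    ≡⟨ length-++ (map (f x) ys) ⟩
  length (map (f x) ys) + length (cartesianProductWith f xs ys)
    ≡⟨ cong₂ _+_ (length-map (f x) ys) (length-cartesianProductWith f xs ys) ⟩
  length ys + length xs * length ys ∎
  where open ≡-Reasoning

drop-++ : (xs : Vec X k) (ys : Vec X m) → drop k (xs ++ ys) ≡ ys
drop-++ []       ys = refl
drop-++ (_ ∷ xs) ys = drop-++ xs ys

drop-⊆ : ∀ k {p q : Subset (k + m)} → p ⊆ q → drop k p ⊆ drop k q
drop-⊆ zero    p⊆q = p⊆q
drop-⊆ (suc k) {_ ∷ p} {_ ∷ q} p⊆q = drop-⊆ k (drop-∷-⊆ p⊆q)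

⊥++p⊆q++p : (q : Subset k) {p : Subset m} → ⊥ ++ p ⊆ q ++ p
⊥++p⊆q++p []      x∈p = x∈p
⊥++p⊆q++p (_ ∷ q) x∈p = out⊆ (⊥++p⊆q++p q) x∈p

p⊆q∧∣p∣≡∣q∣⇒p≡q : {p q : Subset n} → p ⊆ q → ∣ p ∣ ≡ ∣ q ∣ → p ≡ q
p⊆q∧∣p∣≡∣q∣⇒p≡q {p = []}          {[]}          _   _  = refl
p⊆q∧∣p∣≡∣q∣⇒p≡q {p = outside ∷ p} {outside ∷ q} p⊆q eq =
  cong (outside ∷_) (p⊆q∧∣p∣≡∣q∣⇒p≡q (drop-∷-⊆ p⊆q) eq)
p⊆q∧∣p∣≡∣q∣⇒p≡q {p = inside ∷ p}  {inside ∷ q}  p⊆q eq =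
  cong (inside ∷_) (p⊆q∧∣p∣≡∣q∣⇒p≡q (drop-∷-⊆ p⊆q) (suc-injective eq))
p⊆q∧∣p∣≡∣q∣⇒p≡q {p = inside ∷ p}  {outside ∷ q} p⊆q _ with () ← p⊆q Vec.here
p⊆q∧∣p∣≡∣q∣⇒p≡q {p = outside ∷ p} {inside ∷ q}  p⊆q eq =
  contradiction (subst (_≤ ∣ q ∣) eq (p⊆q⇒∣p∣≤∣q∣ (drop-∷-⊆ p⊆q))) (n≮n ∣ q ∣)

Antichain : List (Subset n) → Set
Antichain 𝒜 = ∀ {p q} → p ∈ 𝒜 → q ∈ 𝒜 → p ⊆ q → p ≡ q

AllComponentsOfOrder : Family n → ℕ → Set
AllComponentsOfOrder {n} 𝓕 c = ∀ A → A ∈ 𝓕 → Σ (List (Subset n)) (λ C →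
  Unique C × IsComponentOf 𝓕 A C × length C ≡ c)

branch : List (Subset n) → List (Subset n) → List (Subset (suc n))
branch xs ys = map (outside ∷_) xs List.++ map (inside ∷_) ys

module _ {xs ys : List (Subset n)} where

  ∈-branch⁺ˡ : ∀ {p} → p ∈ xs → outside ∷ p ∈ branch xs ys
  ∈-branch⁺ˡ p∈xs = ∈-++⁺ˡ (∈-map⁺ (outside ∷_) p∈xs)

  ∈-branch⁺ʳ : ∀ {p} → p ∈ ys → inside ∷ p ∈ branch xs ys
  ∈-branch⁺ʳ p∈ys = ∈-++⁺ʳ (map (outside ∷_) xs) (∈-map⁺ (inside ∷_) p∈ys)

  branch-unique : Unique xs → Unique ys → Unique (branch xs ys)
  branch-unique !xs !ys =
    Unique.++⁺ (Unique.map⁺ ∷-injectiveʳ !xs) (Unique.map⁺ ∷-injectiveʳ !ys) disjoint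
    where
    disjoint : ∀ {p} → ¬ (p ∈ map (outside ∷_) xs × p ∈ map (inside ∷_) ys)
    disjoint (p∈l , p∈r) with _ , _ , refl ← ∈-map⁻ (outside ∷_) p∈l
                            | _ , _ , () ← ∈-map⁻ (inside ∷_) p∈r

length-branch : (xs ys : List (Subset n)) → length (branch xs ys) ≡ length xs + length ys
length-branch xs ys = trans (length-++ (map (outside ∷_) xs))
  (cong₂ _+_ (length-map (outside ∷_) xs) (length-map (inside ∷_) ys))

allSubsets : ∀ n → List (Subset n)
allSubsets zero    = [ [] ]
allSubsets (suc n) = branch (allSubsets n) (allSubsets n)

allSubsets-unique : ∀ n → Unique (allSubsets n)
allSubsets-unique zero    = All.[] Unique.∷ Unique.[]
allSubsets-unique (suc n) = branch-unique (allSubsets-unique n) (allSubsets-unique n)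

length-allSubsets : ∀ n → length (allSubsets n) ≡ 2 ^ n
length-allSubsets zero    = refl
length-allSubsets (suc n) = begin
  length (branch (allSubsets n) (allSubsets n))   ≡⟨ length-branch (allSubsets n) (allSubsets n) ⟩
  length (allSubsets n) + length (allSubsets n)   ≡⟨ cong (λ l → l + l) (length-allSubsets n) ⟩
  2 ^ n + 2 ^ n                                   ≡⟨ cong (2 ^ n +_) (+-identityʳ (2 ^ n)) ⟨
  2 ^ suc n                                       ∎
  where open ≡-Reasoning

∈-allSubsets : (p : Subset n) → p ∈ allSubsets n
∈-allSubsets []            = here refl
∈-allSubsets (outside ∷ p) = ∈-branch⁺ˡ (∈-allSubsets p)
∈-allSubsets (inside ∷ p)  = ∈-branch⁺ʳ (∈-allSubsets p)

subsetsOfSize : ∀ n → ℕ → List (Subset n)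
subsetsOfSize zero    zero    = [ [] ]
subsetsOfSize zero    (suc r) = []
subsetsOfSize (suc n) zero    = branch (subsetsOfSize n zero) []
subsetsOfSize (suc n) (suc r) = branch (subsetsOfSize n (suc r)) (subsetsOfSize n r)

subsetsOfSize-unique : ∀ n r → Unique (subsetsOfSize n r)
subsetsOfSize-unique zero    zero    = All.[] Unique.∷ Unique.[]
subsetsOfSize-unique zero    (suc r) = Unique.[]
subsetsOfSize-unique (suc n) zero    = branch-unique (subsetsOfSize-unique n zero) Unique.[]
subsetsOfSize-unique (suc n) (suc r) =
  branch-unique (subsetsOfSize-unique n (suc r)) (subsetsOfSize-unique n r)

length-subsetsOfSize : ∀ n r → length (subsetsOfSize n r) ≡ n C r
length-subsetsOfSize zero    zero    = refl
length-subsetsOfSize zero    (suc r) = refl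
length-subsetsOfSize (suc n) zero    =
  trans (length-branch (subsetsOfSize n zero) []) (trans (+-identityʳ _) (length-subsetsOfSize n zero))
length-subsetsOfSize (suc n) (suc r) = begin
  length (subsetsOfSize (suc n) (suc r))
    ≡⟨ length-branch (subsetsOfSize n (suc r)) (subsetsOfSize n r) ⟩
  length (subsetsOfSize n (suc r)) + length (subsetsOfSize n r)
    ≡⟨ cong₂ _+_ (length-subsetsOfSize n (suc r)) (length-subsetsOfSize n r) ⟩
  n C suc r + n C r
    ≡⟨ +-comm (n C suc r) (n C r) ⟩
  n C r + n C suc r
    ≡⟨ nCk+nC[k+1]≡[n+1]C[k+1] n r ⟩
  suc n C suc r ∎
  where open ≡-Reasoning

subsetsOfSize-size : ∀ n r → All (λ p → ∣ p ∣ ≡ r) (subsetsOfSize n r)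
subsetsOfSize-size zero    zero    = refl All.∷ All.[]
subsetsOfSize-size zero    (suc r) = All.[]
subsetsOfSize-size (suc n) zero    = All.++⁺ (All.map⁺ (subsetsOfSize-size n zero)) All.[]
subsetsOfSize-size (suc n) (suc r) = All.++⁺ (All.map⁺ (subsetsOfSize-size n (suc r)))
                                             (All.map⁺ (All.map (cong suc) (subsetsOfSize-size n r)))

subsetsOfSize-antichain : ∀ n r → Antichain (subsetsOfSize n r)
subsetsOfSize-antichain n r p∈ q∈ p⊆q = p⊆q∧∣p∣≡∣q∣⇒p≡q p⊆q
  (trans (All.lookup (subsetsOfSize-size n r) p∈) (sym (All.lookup (subsetsOfSize-size n r) q∈)))

Adj-sym : {𝓕 : Family n} {A B : Subset n} → Adj 𝓕 A B → Adj 𝓕 B A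
Adj-sym (A∈ , B∈ , A≢B , inj₁ A⊆B) = B∈ , A∈ , A≢B ∘ sym , inj₂ A⊆B
Adj-sym (A∈ , B∈ , A≢B , inj₂ B⊆A) = B∈ , A∈ , A≢B ∘ sym , inj₁ B⊆A

_⊗_ : List (Subset k) → List (Subset m) → Family (k + m)
𝒯 ⊗ 𝒜 = cartesianProductWith _++_ 𝒯 𝒜

⊗-unique : {𝒯 : List (Subset k)} {𝒜 : List (Subset m)} →
  Unique 𝒯 → Unique 𝒜 → Unique (𝒯 ⊗ 𝒜)
⊗-unique = Unique.cartesianProductWith⁺ _++_ (++-injective _ _)

module _ {k m} (𝒯 : List (Subset k)) {𝒜 : List (Subset m)} (antichain : Antichain 𝒜) where

  drop-∈-⊗ : ∀ {p} → p ∈ 𝒯 ⊗ 𝒜 → drop k p ∈ 𝒜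
  drop-∈-⊗ p∈ with T , S , _ , S∈𝒜 , refl ← ∈-cartesianProductWith⁻ _++_ 𝒯 𝒜 p∈ =
    subst (_∈ 𝒜) (sym (drop-++ T S)) S∈𝒜

  Adj-⊗⇒drop≡ : ∀ {p q} → Adj (𝒯 ⊗ 𝒜) p q → drop k p ≡ drop k q
  Adj-⊗⇒drop≡ (p∈ , q∈ , _ , inj₁ p⊆q) = antichain (drop-∈-⊗ p∈) (drop-∈-⊗ q∈) (drop-⊆ k p⊆q)
  Adj-⊗⇒drop≡ (p∈ , q∈ , _ , inj₂ q⊆p) = sym (antichain (drop-∈-⊗ q∈) (drop-∈-⊗ p∈) (drop-⊆ k q⊆p))

  Connected-⊗⇒drop≡ : ∀ {p q} → Connected (𝒯 ⊗ 𝒜) p q → drop k p ≡ drop k q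
  Connected-⊗⇒drop≡ = fold (λ p q → drop k p ≡ drop k q) (trans ∘ Adj-⊗⇒drop≡) refl

  Connected-⊗-++⇒≡ : ∀ T S T′ S′ → Connected (𝒯 ⊗ 𝒜) (T ++ S) (T′ ++ S′) → S ≡ S′
  Connected-⊗-++⇒≡ T S T′ S′ T++S~T′++S′ = begin
    S                 ≡⟨ drop-++ T S ⟨
    drop k (T ++ S)   ≡⟨ Connected-⊗⇒drop≡ T++S~T′++S′ ⟩
    drop k (T′ ++ S′) ≡⟨ drop-++ T′ S′ ⟩
    S′                ∎
    where open ≡-Reasoning

module _ (k : ℕ) {m} {𝒜 : List (Subset m)} (antichain : Antichain 𝒜) where

  private
    𝓕 : Family (k + m)
    𝓕 = allSubsets k ⊗ 𝒜

  ⊥++S-connected : ∀ {S} → S ∈ 𝒜 → (T : Subset k) → Connected 𝓕 (⊥ ++ S) (T ++ S)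
  ⊥++S-connected {S} S∈𝒜 T with ≡-dec Bool._≟_ T ⊥
  ... | yes refl = ε
  ... | no T≢⊥   = (∈-cartesianProductWith⁺ _++_ (∈-allSubsets ⊥) S∈𝒜
                   , ∈-cartesianProductWith⁺ _++_ (∈-allSubsets T) S∈𝒜
                   , T≢⊥ ∘ sym ∘ ++-injectiveˡ ⊥ T
                   , inj₁ (⊥++p⊆q++p T)) ◅ ε

  cube-isComponentOf : ∀ {S} → S ∈ 𝒜 → (T : Subset k) →
    IsComponentOf 𝓕 (T ++ S) (map (_++ S) (allSubsets k))
  cube-isComponentOf {S} S∈𝒜 T B = to , from
    where
    to : B ∈ map (_++ S) (allSubsets k) → B ∈ 𝓕 × Connected 𝓕 (T ++ S) B
    to B∈ with T′ , T′∈ , refl ← ∈-map⁻ (_++ S) B∈ =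
      ∈-cartesianProductWith⁺ _++_ T′∈ S∈𝒜 ,
      reverse Adj-sym (⊥++S-connected S∈𝒜 T) ◅◅ ⊥++S-connected S∈𝒜 T′
    from : B ∈ 𝓕 × Connected 𝓕 (T ++ S) B → B ∈ map (_++ S) (allSubsets k)
    from (B∈ , T++S~B) with T′ , S′ , _ , _ , refl ← ∈-cartesianProductWith⁻ _++_ (allSubsets k) 𝒜 B∈
      with refl ← Connected-⊗-++⇒≡ (allSubsets k) antichain T S T′ S′ T++S~B =
      ∈-map⁺ (_++ S) (∈-allSubsets T′)

  allSubsets⊗-componentsOfOrder : AllComponentsOfOrder 𝓕 (2 ^ k)
  allSubsets⊗-componentsOfOrder A A∈
    with T , S , _ , S∈𝒜 , refl ← ∈-cartesianProductWith⁻ _++_ (allSubsets k) 𝒜 A∈ =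
    map (_++ S) (allSubsets k) ,
    Unique.map⁺ (++-injectiveˡ _ _) (allSubsets-unique k) ,
    cube-isComponentOf S∈𝒜 T ,
    trans (length-map (_++ S) (allSubsets k)) (length-allSubsets k)

proposition1p2 : (k n : ℕ) → k ≤ n →
    Σ (Family n) (λ 𝓕 → Unique 𝓕
      × length 𝓕 ≡ 2 ^ k * ((n ∸ k) C ((n ∸ k) / 2))
      × (∀ A → A ∈ 𝓕 → Σ (List (Subset n)) (λ C →
            Unique C × IsComponentOf 𝓕 A C × length C ≡ 2 ^ k)))
proposition1p2 k n k≤n with m , refl ← m≤n⇒∃[o]m+o≡n k≤n =
  𝓕 ,
  ⊗-unique (allSubsets-unique k) (subsetsOfSize-unique m (m / 2)) ,
  length-𝓕 ,
  allSubsets⊗-componentsOfOrder k (subsetsOfSize-antichain m (m / 2))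
  where
  𝓕 : Family (k + m)
  𝓕 = allSubsets k ⊗ subsetsOfSize m (m / 2)

  length-𝓕 : length 𝓕 ≡ 2 ^ k * ((k + m ∸ k) C ((k + m ∸ k) / 2))
  length-𝓕 rewrite m+n∸m≡n k m = begin
    length 𝓕
      ≡⟨ length-cartesianProductWith _++_ (allSubsets k) (subsetsOfSize m (m / 2)) ⟩
    length (allSubsets k) * length (subsetsOfSize m (m / 2))
      ≡⟨ cong₂ _*_ (length-allSubsets k) (length-subsetsOfSize m (m / 2)) ⟩
    2 ^ k * (m C (m / 2)) ∎
    where open ≡-Reasoning
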